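{- Let $D$ be a digraph with underlying graph $U(D)$. Suppose $U(D)$ has distinct vertices $x,y$ with cards $A\cong U(D)-x$ and $B\cong U(D)-y$ such that $A$ and $B$ have a unique pasting as members of $\mathrm{Deck}(U(D))$, and no card of $\mathrm{Deck}(U(D))$ other than $U(D)-x$ and $U(D)-y$ is isomorphic to $A$ or to $B$. Then $D$ is da-reconstructible.
   Context: Digraphs are finite, without loops or multiple arcs. The underlying graph $U(D)$ has vertex set $V(D)$, with $xy$ an edge iff at least one of $xy,yx$ is an arc of $D$. For a vertex $x$ of $D$, $\mathrm{dt}_D(x)=(a,b,c)$ where $a,b,c$ are the numbers of vertices $w$ such that respectively only $xw$, only $wx$, both $xw,wx$ are arcs. The dadeck of $D$ is the multiset of pairs $(D-x,\mathrm{dt}_D(x))$, $x\in V(D)$ (digraphs up to isomorphism); digraphs with the same dadeck are da-hypomorphs; $D$ is da-reconstructible if it is isomorphic to all its da-hypomorphs. The deck $\mathrm{Deck}(G)$ of a graph $G$ is the multiset of isomorphism classes of $G-x$, $x\in V(G)$; graphs with the same deck are hypomorphs. Pasting of cards of a graph $G$: if $A\cong G-v_1$, $B\cong G-v_2$ with $v_1\neq v_2$, a pasting of $A,B$ as members of $\mathrm{Deck}(G)$ is a graph $P$ with two distinct non-adjacent vertices $u,v$ (external vertices) such that $P-u\cong A$, $P-v\cong B$ and $P$ or $P+uv$ is a hypomorph of $G$. Given such $P$ and isomorphisms $\beta_A:A\to P-u$, $\beta_B:B\to P-v$, set $v^*=\beta_A^{ -1}(v)\in V(A)$, $u^*=\beta_B^{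 -1}(u)\in V(B)$; then $\beta_B^{ -1}\beta_A$ is an isomorphism $A-v^*\to B-u^*$. $A$ and $B$ have a unique pasting as members of $\mathrm{Deck}(G)$ if the vertices $v^*$, $u^*$ and the map $\beta_B^{ -1}\beta_A$ on $V(A)\setminus\{v^*\}$ are the same for every choice of pasting $P$ of $A,B$ as members of $\mathrm{Deck}(G)$ (and of the isomorphisms $\beta_A,\beta_B$). -}

module Defs where

open import Data.Nat using (ℕ; zero; suc; _+_)
open import Data.Bool using (Bool; true; false; _∨_; _∧_; not; if_then_else_)
open import Data.Fin using (Fin; zero; suc; punchIn; _≟_)
open import Data.Fin.Permutation using (Permutation′; _⟨$⟩ʳ_)
open import Data.Product using (_×_; Σ; ∃)
open import Data.Sum using (_⊎_)
open import Relation.Binary.PropositionalEquality using (_≡_; _≢_)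
open import Relation.Nullary using (¬_; does)

Adj : ℕ → Set
Adj n = Fin n → Fin n → Bool

record Iso {n : ℕ} (R S : Adj n) : Set where
  field
    σ        : Permutation′ n
    preserve : ∀ i j → R i j ≡ S (σ ⟨$⟩ʳ i) (σ ⟨$⟩ʳ j)
open Iso public

del : ∀ {n} → Adj (suc n) → Fin (suc n) → Adj n
del R x i j = R (punchIn x i) (punchIn x j)

addEdge : ∀ {n} → Adj n → Fin n → Fin n → Adj n
addEdge R u v i j =
  R i j ∨ ((does (i ≟ u) ∧ does (j ≟ v)) ∨ (does (i ≟ v) ∧ does (j ≟ u)))

record Digraph (n : ℕ) : Set where
  field
    arc   : Adj n
    loopless : ∀ i → arc i i ≡ false
open Digraph public

record Graph (n : ℕ) : Set where
  field
    edge  : Adj n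
    irrefl : ∀ i → edge i i ≡ false
    symm  : ∀ i j → edge i j ≡ edge j i
open Graph public

U : ∀ {n} → Digraph n → Graph n
U D = record
  { edge = λ i j → arc D i j ∨ arc D j i
  ; irrefl = λ i → lemma (arc D i i) (loopless D i)
  ; symm = λ i j → ∨-comm (arc D i j) (arc D j i)
  }
  where
  lemma : ∀ b → b ≡ false → (b ∨ b) ≡ false
  lemma .false _≡_.refl = _≡_.refl
  ∨-comm : ∀ a b → (a ∨ b) ≡ (b ∨ a)
  ∨-comm false false = _≡_.refl
  ∨-comm false true = _≡_.refl
  ∨-comm true false = _≡_.refl
  ∨-comm true true = _≡_.refl

-- Decks and hypomorphs of graphs (on raw adjacency of the same order;
-- equality of decks as multisets of isomorphism classes = a bijection
-- π of the vertex sets with R - i ≅ S - π(i) for all i).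

Hypomorph : ∀ {n} → Adj (suc n) → Adj (suc n) → Set
Hypomorph {n} R S =
  Σ (Permutation′ (suc n)) λ π → ∀ i → Iso (del R i) (del S (π ⟨$⟩ʳ i))

count : ∀ {n} → (Fin n → Bool) → ℕ
count {zero}  f = 0
count {suc n} f = (if f zero then 1 else 0) + count (λ i → f (suc i))

dt : ∀ {n} → Digraph n → Fin n → ℕ × ℕ × ℕ
dt D x =
  count (λ w → arc D x w ∧ not (arc D w x)) Data.Product.,
  count (λ w → not (arc D x w) ∧ arc D w x) Data.Product.,
  count (λ w → arc D x w ∧ arc D w x)

-- Same dadeck (as multisets of pairs (D - x , dt_D(x)))
DaHypomorph : ∀ {n} → Digraph (suc n) → Digraph (suc n) → Set
DaHypomorph {n} D E =
  Σ (Permutation′ (suc n)) λ π → ∀ x →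
    Iso (del (arc D) x) (del (arc E) (π ⟨$⟩ʳ x)) × (dt D x ≡ dt E (π ⟨$⟩ʳ x))

DaReconstructible : ∀ {n} → Digraph (suc n) → Set
DaReconstructible {n} D = ∀ (E : Digraph (suc n)) → DaHypomorph D E → Iso (arc D) (arc E)

record Pasting {n : ℕ} (G : Graph (suc n)) (A B : Graph n) : Set where
  field
    P      : Graph (suc n)
    u v    : Fin (suc n)
    u≢v    : u ≢ v
    nonadj : edge P u v ≡ false
    βA     : Iso (edge A) (del (edge P) u)
    βB     : Iso (edge B) (del (edge P) v)
    hypo   : Hypomorph (edge P) (edge G) ⊎ Hypomorph (addEdge (edge P) u v) (edge G)
open Pasting public

-- v* = βA⁻¹(v) : the vertex a of A whose image in P is v
IsVStar : ∀ {n} {G : Graph (suc n)} {A B : Graph n} → Pasting G A B → Fin n → Set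
IsVStar p a = punchIn (u p) (σ (βA p) ⟨$⟩ʳ a) ≡ v p

IsUStar : ∀ {n} {G : Graph (suc n)} {A B : Graph n} → Pasting G A B → Fin n → Set
IsUStar p b = punchIn (v p) (σ (βB p) ⟨$⟩ʳ b) ≡ u p

-- graph of the map βB⁻¹ βA on V(A) ∖ {v*}: a ↦ b iff βA a and βB b are
-- the same vertex of P
Glue : ∀ {n} {G : Graph (suc n)} {A B : Graph n} → Pasting G A B → Fin n → Fin n → Set
Glue p a b = punchIn (u p) (σ (βA p) ⟨$⟩ʳ a) ≡ punchIn (v p) (σ (βB p) ⟨$⟩ʳ b)

UniquePasting : ∀ {n} → Graph (suc n) → Graph n → Graph n → Set
UniquePasting G A B =
  ∀ (p q : Pasting G A B) →
    (∀ a a' → IsVStar p a → IsVStar q a' → a ≡ a') ×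
    (∀ b b' → IsUStar p b → IsUStar q b' → b ≡ b') ×
    (∀ a b b' → Glue p a b → Glue q a b' → b ≡ b')

-- Let π witness that E is a da-hypomorph of D, and write x′ = π x, y′ = π y. The card
-- isomorphisms D - x ≅ E - x′ and D - y ≅ E - y′ extend to permutations τx, τy of V(D)
-- by x ↦ x′ and y ↦ y′. Removing the edge xy from U(D) and the edge x′y′ from U(E)
-- yields two pastings of A and B as members of Deck(U(D)), and uniqueness of the pasting
-- forces τx = τy. This single permutation preserves every arc not joining x and y, and
-- the degree triples of x in D and of x′ in E then fix the arcs between x and y.
module Submission where

open import Defs
open import Data.Nat using (ℕ; suc; _+_)
open import Data.Nat.Properties using (+-0-commutativeMonoid; +-cancelʳ-≡)
open import Data.Bool using (Bool; true; false; _∨_; _∧_; not; if_then_else_)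
open import Data.Bool.Properties using (∨-comm; ∧-comm; ∨-identityʳ; ∧-identityʳ; ∧-zeroʳ; ∨-zeroʳ)
open import Data.Fin using (Fin; zero; suc; punchIn; punchOut; _≟_)
open import Data.Fin.Properties using (punchInᵢ≢i; punchIn-punchOut)
open import Data.Fin.Permutation
  using (Permutation′; _⟨$⟩ʳ_; _⟨$⟩ˡ_; inverseʳ; inverseˡ; flip; _∘ₚ_; id; insert; insert-punchIn)
open import Data.Product using (_×_; _,_; proj₁; proj₂; Σ)
open import Function using (_∘_)
open import Data.Sum using (_⊎_; inj₁; inj₂)
open import Data.Empty using (⊥-elim)
open import Relation.Binary.PropositionalEquality
  using (_≢_; _≡_; refl; sym; trans; cong; cong₂; subst; module ≡-Reasoning)
open import Relation.Nullary using (¬_; does; yes; no)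
open import Relation.Nullary.Decidable using (dec-true; dec-false)
open import Algebra.Properties.CommutativeMonoid.Sum +-0-commutativeMonoid
  using (sum; sum-cong-≗; sum-remove; sum-permute)

open ≡-Reasoning

private
  variable
    n : ℕ

_≗₂_ : Adj n → Adj n → Set
R ≗₂ S = ∀ i j → R i j ≡ S i j

Iso-refl : {R : Adj n} → Iso R R
Iso-refl = record { σ = id ; preserve = λ _ _ → refl }

Iso-sym : {R S : Adj n} → Iso R S → Iso S R
Iso-sym {S = S} I = record
  { σ = flip (σ I)
  ; preserve = λ i j →
      trans (cong₂ S (sym (inverseʳ (σ I))) (sym (inverseʳ (σ I))))
            (sym (preserve I (σ I ⟨$⟩ˡ i) (σ I ⟨$⟩ˡ j)))
  }

Iso-trans : {R S T : Adj n} → Iso R S → Iso S T → Iso R T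
Iso-trans I J = record
  { σ = σ I ∘ₚ σ J ; preserve = λ i j → trans (preserve I i j) (preserve J _ _) }

Iso-respˡ : {R R′ S : Adj n} → R′ ≗₂ R → Iso R S → Iso R′ S
Iso-respˡ e I = record { σ = σ I ; preserve = λ i j → trans (e i j) (preserve I i j) }

Iso-respʳ : {R S S′ : Adj n} → Iso R S → S ≗₂ S′ → Iso R S′
Iso-respʳ I e = record { σ = σ I ; preserve = λ i j → trans (preserve I i j) (e _ _) }

symmetrise : Adj n → Adj n
symmetrise R i j = R i j ∨ R j i

Iso-symmetrise : {R S : Adj n} → Iso R S → Iso (symmetrise R) (symmetrise S)
Iso-symmetrise I = record
  { σ = σ I ; preserve = λ i j → cong₂ _∨_ (preserve I i j) (preserve I j i) }

Hypomorph-refl : {R : Adj (suc n)} → Hypomorph R R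
Hypomorph-refl = id , λ _ → Iso-refl

Hypomorph-sym : {R S : Adj (suc n)} → Hypomorph R S → Hypomorph S R
Hypomorph-sym {R = R} {S} (π , cards) = flip π , λ i →
  Iso-sym (subst (λ k → Iso (del R (π ⟨$⟩ˡ i)) (del S k)) (inverseʳ π) (cards (π ⟨$⟩ˡ i)))

Hypomorph-respˡ : {R R′ S : Adj (suc n)} → R′ ≗₂ R → Hypomorph R S → Hypomorph R′ S
Hypomorph-respˡ e (π , cards) = π , λ i → Iso-respˡ (λ _ _ → e _ _) (cards i)

-- del (edge (U D)) x is definitionally symmetrise (del (arc D) x).
DaHypomorph⇒Hypomorph-U : {D E : Digraph (suc n)} →
  DaHypomorph D E → Hypomorph (edge (U D)) (edge (U E))
DaHypomorph⇒Hypomorph-U {D = D} {E} (π , cards) = π , λ i →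
  Iso-symmetrise {R = del (arc D) i} {del (arc E) (π ⟨$⟩ʳ i)} (proj₁ (cards i))

isEndpointPair : Fin n → Fin n → Adj n
isEndpointPair u v i j = (does (i ≟ u) ∧ does (j ≟ v)) ∨ (does (i ≟ v) ∧ does (j ≟ u))

removeEdge : Adj n → Fin n → Fin n → Adj n
removeEdge R u v i j = R i j ∧ not (isEndpointPair u v i j)

module _ {u v : Fin n} where

  isEndpointPair-sym : ∀ i j → isEndpointPair u v i j ≡ isEndpointPair u v j i
  isEndpointPair-sym i j =
    trans (cong₂ _∨_ (∧-comm (does (i ≟ u)) _) (∧-comm (does (i ≟ v)) _))
          (∨-comm (does (j ≟ v) ∧ does (i ≟ u)) _)

  isEndpointPair-self : isEndpointPair u v u v ≡ true
  isEndpointPair-self rewrite dec-true (u ≟ u) refl | dec-true (v ≟ v) refl = refl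

  isEndpointPair⇒edge : {R : Adj n} → (∀ i j → R i j ≡ R j i) →
    ∀ {i j} → isEndpointPair u v i j ≡ true → R i j ≡ R u v
  isEndpointPair⇒edge {R} R-sym {i} {j} e with i ≟ u | j ≟ v | i ≟ v | j ≟ u
  ... | yes refl | yes refl | _        | _        = refl
  ... | _        | _        | yes refl | yes refl = R-sym v u
  isEndpointPair⇒edge _ () | no _  | _    | no _  | _
  isEndpointPair⇒edge _ () | no _  | _    | yes _ | no _
  isEndpointPair⇒edge _ () | yes _ | no _ | no _  | _
  isEndpointPair⇒edge _ () | yes _ | no _ | yes _ | no _

  removeEdge-≗ : {R : Adj n} → (∀ i j → R i j ≡ R j i) → R u v ≡ false → removeEdge R u v ≗₂ R
  removeEdge-≗ {R} R-sym Ruv i j with isEndpointPair u v i j in e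
  ... | false = ∧-identityʳ (R i j)
  ... | true  = trans (∧-zeroʳ (R i j)) (sym (trans (isEndpointPair⇒edge R-sym e) Ruv))

  addEdge-removeEdge : {R : Adj n} → (∀ i j → R i j ≡ R j i) → R u v ≡ true →
    addEdge (removeEdge R u v) u v ≗₂ R
  addEdge-removeEdge {R} R-sym Ruv i j with isEndpointPair u v i j in e
  ... | false = trans (∨-identityʳ _) (∧-identityʳ (R i j))
  ... | true  = trans (∨-zeroʳ _) (sym (trans (isEndpointPair⇒edge R-sym e) Ruv))

  removeEdge-off : ∀ (R : Adj n) i j → isEndpointPair u v i j ≡ false → removeEdge R u v i j ≡ R i j
  removeEdge-off R i j e rewrite e = ∧-identityʳ (R i j)

  isEndpointPair-avoidsˡ : ∀ {i j} → i ≢ u → j ≢ u → isEndpointPair u v i j ≡ false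
  isEndpointPair-avoidsˡ {i} {j} i≢u j≢u
    rewrite dec-false (i ≟ u) i≢u | dec-false (j ≟ u) j≢u = ∧-zeroʳ _

  isEndpointPair-avoidsʳ : ∀ {i j} → i ≢ v → j ≢ v → isEndpointPair u v i j ≡ false
  isEndpointPair-avoidsʳ {i} {j} i≢v j≢v
    rewrite dec-false (i ≟ v) i≢v | dec-false (j ≟ v) j≢v = trans (∨-identityʳ _) (∧-zeroʳ _)

module _ {R : Adj (suc n)} {u v : Fin (suc n)} where

  del-removeEdgeˡ : del (removeEdge R u v) u ≗₂ del R u
  del-removeEdgeˡ i j = removeEdge-off R _ _ (isEndpointPair-avoidsˡ {v = v} (punchInᵢ≢i u i) (punchInᵢ≢i u j))

  del-removeEdgeʳ : del (removeEdge R u v) v ≗₂ del R v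
  del-removeEdgeʳ i j = removeEdge-off R _ _ (isEndpointPair-avoidsʳ {u = u} (punchInᵢ≢i v i) (punchInᵢ≢i v j))

module _ (G H : Graph (suc n)) {A B : Graph n} {u v : Fin (suc n)} (u≢v : u ≢ v)
         (αA : Iso (edge A) (del (edge H) u)) (αB : Iso (edge B) (del (edge H) v))
         (H≈G : Hypomorph (edge H) (edge G)) where

  removeEdgeGraph : Graph (suc n)
  removeEdgeGraph = record
    { edge   = removeEdge (edge H) u v
    ; irrefl = λ i → cong (_∧ _) (irrefl H i)
    ; symm   = λ i j → cong₂ (λ a b → a ∧ not b) (symm H i j) (isEndpointPair-sym i j)
    }

  removeEdge-hypo : Hypomorph (removeEdge (edge H) u v) (edge G)
                  ⊎ Hypomorph (addEdge (removeEdge (edge H) u v) u v) (edge G)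
  removeEdge-hypo with edge H u v in e
  ... | false = inj₁ (Hypomorph-respˡ {S = edge G} (removeEdge-≗ (symm H) e) H≈G)
  ... | true  = inj₂ (Hypomorph-respˡ {S = edge G} (addEdge-removeEdge (symm H) e) H≈G)

  pastingByRemovingEdge : Pasting G A B
  pastingByRemovingEdge = record
    { P      = removeEdgeGraph
    ; u      = u
    ; v      = v
    ; u≢v    = u≢v
    ; nonadj = trans (cong (λ b → edge H u v ∧ not b) (isEndpointPair-self {u = u} {v})) (∧-zeroʳ _)
    ; βA     = Iso-respʳ αA (λ i j → sym (del-removeEdgeˡ {R = edge H} {u} {v} i j))
    ; βB     = Iso-respʳ αB (λ i j → sym (del-removeEdgeʳ {R = edge H} {u} {v} i j))
    ; hypo   = removeEdge-hypo
    }

embedA : {G : Graph (suc n)} {A B : Graph n} → Pasting G A B → Fin n → Fin (suc n)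
embedA p a = punchIn (u p) (σ (βA p) ⟨$⟩ʳ a)

embedB : {G : Graph (suc n)} {A B : Graph n} → Pasting G A B → Fin n → Fin (suc n)
embedB p b = punchIn (v p) (σ (βB p) ⟨$⟩ʳ b)

module _ {G : Graph (suc n)} {A B : Graph n} where

  embedA-onto : (p : Pasting G A B) {w : Fin (suc n)} → u p ≢ w → Σ (Fin n) λ a → embedA p a ≡ w
  embedA-onto p u≢w =
    σ (βA p) ⟨$⟩ˡ punchOut u≢w ,
    trans (cong (punchIn (u p)) (inverseʳ (σ (βA p)))) (punchIn-punchOut u≢w)

  embedB-onto : (p : Pasting G A B) {w : Fin (suc n)} → v p ≢ w → Σ (Fin n) λ b → embedB p b ≡ w
  embedB-onto p v≢w =
    σ (βB p) ⟨$⟩ˡ punchOut v≢w ,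
    trans (cong (punchIn (v p)) (inverseʳ (σ (βB p)))) (punchIn-punchOut v≢w)

module _ {G : Graph (suc n)} {A B : Graph n} (unique : UniquePasting G A B) where

  vStar-transfer : (p q : Pasting G A B) {a : Fin n} → embedA p a ≡ v p → embedA q a ≡ v q
  vStar-transfer p q {a} e =
    let a′ , e′ = embedA-onto q (u≢v q)
    in subst (λ c → embedA q c ≡ v q) (sym (proj₁ (unique p q) a a′ e e′)) e′

  uStar-transfer : (p q : Pasting G A B) {b : Fin n} → embedB p b ≡ u p → embedB q b ≡ u q
  uStar-transfer p q {b} e =
    let b′ , e′ = embedB-onto q (u≢v q ∘ sym)
    in subst (λ c → embedB q c ≡ u q) (sym (proj₁ (proj₂ (unique p q)) b b′ e e′)) e′

  glue-transfer : (p q : Pasting G A B) {a b : Fin n} → embedA p a ≡ embedB p b → embedA q a ≡ embedB q b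
  glue-transfer p q {a} {b} e =
    let b′ , e′ = embedB-onto q v≢embedA
    in trans (sym e′) (cong (embedB q) (sym (proj₂ (proj₂ (unique p q)) a b b′ e (sym e′))))
    where
    v≢embedA : v q ≢ embedA q a
    v≢embedA h = punchInᵢ≢i (v p) _ (trans (sym e) (vStar-transfer q p (sym h)))

indicator : Bool → ℕ
indicator b = if b then 1 else 0

indicator-injective : ∀ {a b} → indicator a ≡ indicator b → a ≡ b
indicator-injective {false} {false} _ = refl
indicator-injective {true}  {true}  _ = refl

count≡sum : (f : Fin n → Bool) → count f ≡ sum (λ i → indicator (f i))
count≡sum {0}     f = refl
count≡sum {suc n}  f = cong (indicator (f zero) +_) (count≡sum (λ i → f (suc i)))

count-cancel : (τ : Permutation′ (suc n)) (f g : Fin (suc n) → Bool) (y : Fin (suc n)) →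
  (∀ w → w ≢ y → f w ≡ g (τ ⟨$⟩ʳ w)) → count f ≡ count g → f y ≡ g (τ ⟨$⟩ʳ y)
count-cancel τ f g y agree same = indicator-injective (+-cancelʳ-≡ rest _ _ (begin
  indicator (f y) + rest                   ≡⟨ sum-remove {i = y} (λ w → indicator (f w)) ⟨
  sum (λ w → indicator (f w))              ≡⟨ count≡sum f ⟨
  count f                                  ≡⟨ same ⟩
  count g                                  ≡⟨ count≡sum g ⟩
  sum (λ w → indicator (g w))              ≡⟨ sum-permute (λ w → indicator (g w)) τ ⟩
  sum (λ w → indicator (g (τ ⟨$⟩ʳ w)))     ≡⟨ sum-remove {i = y} (λ w → indicator (g (τ ⟨$⟩ʳ w))) ⟩
  indicator (g (τ ⟨$⟩ʳ y)) + rest′         ≡⟨ cong (indicator (g (τ ⟨$⟩ʳ y)) +_) rest≡rest′ ⟨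
  indicator (g (τ ⟨$⟩ʳ y)) + rest          ∎))
  where
  rest rest′ : ℕ
  rest  = sum (λ j → indicator (f (punchIn y j)))
  rest′ = sum (λ j → indicator (g (τ ⟨$⟩ʳ punchIn y j)))
  rest≡rest′ : rest ≡ rest′
  rest≡rest′ = sum-cong-≗ (λ j → cong indicator (agree (punchIn y j) (punchInᵢ≢i y j)))

-- The three components of dt count the patterns (true , false), (false , true) and
-- (true , true) of the pair of arcs (xw , wx).
pair-from-patterns : ∀ {p q p′ q′} → p ∧ not q ≡ p′ ∧ not q′ → not p ∧ q ≡ not p′ ∧ q′ →
  p ∧ q ≡ p′ ∧ q′ → p ≡ p′ × q ≡ q′
pair-from-patterns {p} {q} {p′} {q′} e₁ e₂ e₃ =
  trans (sym (fst p q)) (trans (cong₂ _∨_ e₁ e₃) (fst p′ q′)) ,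
  trans (sym (snd p q)) (trans (cong₂ _∨_ e₂ e₃) (snd p′ q′))
  where
  fst : ∀ p q → (p ∧ not q) ∨ (p ∧ q) ≡ p
  fst false _     = refl
  fst true  false = refl
  fst true  true  = refl
  snd : ∀ p q → (not p ∧ q) ∨ (p ∧ q) ≡ q
  snd false q = ∨-identityʳ q
  snd true  _ = refl

PreservesOff : Adj n → Adj n → Permutation′ n → Fin n → Set
PreservesOff R S τ z = ∀ i j → i ≢ z → j ≢ z → R i j ≡ S (τ ⟨$⟩ʳ i) (τ ⟨$⟩ʳ j)

insert-self : (z : Fin (suc n)) (z′ : Fin (suc n)) (π : Permutation′ n) → insert z z′ π ⟨$⟩ʳ z ≡ z′
insert-self z z′ π with z ≟ z
... | yes _   = refl
... | no z≢z  = ⊥-elim (z≢z refl)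

insert-preservesOff : {R S : Adj (suc n)} {z z′ : Fin (suc n)} (I : Iso (del R z) (del S z′)) →
  PreservesOff R S (insert z z′ (σ I)) z
insert-preservesOff {R = R} {S} {z} {z′} I i j i≢z j≢z = begin
  R i j                                                  ≡⟨ cong₂ R hi hj ⟨
  R (punchIn z k) (punchIn z l)                          ≡⟨ preserve I k l ⟩
  S (punchIn z′ (σ I ⟨$⟩ʳ k)) (punchIn z′ (σ I ⟨$⟩ʳ l))  ≡⟨ cong₂ S (insert-punchIn z z′ (σ I) k) (insert-punchIn z z′ (σ I) l) ⟨
  S (τ ⟨$⟩ʳ punchIn z k) (τ ⟨$⟩ʳ punchIn z l)            ≡⟨ cong₂ (λ a b → S (τ ⟨$⟩ʳ a) (τ ⟨$⟩ʳ b)) hi hj ⟩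
  S (τ ⟨$⟩ʳ i) (τ ⟨$⟩ʳ j)                                ∎
  where
  τ = insert z z′ (σ I)
  k = punchOut (i≢z ∘ sym)
  l = punchOut (j≢z ∘ sym)
  hi = punchIn-punchOut (i≢z ∘ sym)
  hj = punchIn-punchOut (j≢z ∘ sym)

module _ (D E : Digraph (suc n)) (τ : Permutation′ (suc n)) {x y : Fin (suc n)} (x≢y : x ≢ y) where

  dt⇒arcs-between : PreservesOff (arc D) (arc E) τ y → dt D x ≡ dt E (τ ⟨$⟩ʳ x) →
    arc D x y ≡ arc E (τ ⟨$⟩ʳ x) (τ ⟨$⟩ʳ y) × arc D y x ≡ arc E (τ ⟨$⟩ʳ y) (τ ⟨$⟩ʳ x)
  dt⇒arcs-between offʸ dt≡ = pair-from-patterns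
    (component (λ a b → a ∧ not b) (cong proj₁ dt≡))
    (component (λ a b → not a ∧ b) (cong (proj₁ ∘ proj₂) dt≡))
    (component _∧_ (cong (proj₂ ∘ proj₂) dt≡))
    where
    x′ = τ ⟨$⟩ʳ x
    component : (c : Bool → Bool → Bool) →
      count (λ w → c (arc D x w) (arc D w x)) ≡ count (λ w → c (arc E x′ w) (arc E w x′)) →
      c (arc D x y) (arc D y x) ≡ c (arc E x′ (τ ⟨$⟩ʳ y)) (arc E (τ ⟨$⟩ʳ y) x′)
    component c = count-cancel τ (λ w → c (arc D x w) (arc D w x)) (λ w → c (arc E x′ w) (arc E w x′)) y
      λ w w≢y → cong₂ c (offʸ x w x≢y w≢y) (offʸ w x w≢y x≢y)

  Iso-fromPreservesOff : PreservesOff (arc D) (arc E) τ x → PreservesOff (arc D) (arc E) τ y →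
    dt D x ≡ dt E (τ ⟨$⟩ʳ x) → Iso (arc D) (arc E)
  Iso-fromPreservesOff offˣ offʸ dt≡ = record { σ = τ ; preserve = preserves }
    where
    y≢x : y ≢ x
    y≢x = x≢y ∘ sym
    between = dt⇒arcs-between offʸ dt≡
    preserves : ∀ i j → arc D i j ≡ arc E (τ ⟨$⟩ʳ i) (τ ⟨$⟩ʳ j)
    preserves i j with i ≟ y | j ≟ y
    ... | no i≢y   | no j≢y   = offʸ i j i≢y j≢y
    ... | yes refl | yes refl = offˣ y y y≢x y≢x
    ... | yes refl | no j≢y with j ≟ x
    ...   | yes refl = proj₂ between
    ...   | no j≢x   = offˣ y j y≢x j≢x
    preserves i j | no i≢y | yes refl with i ≟ x
    ...   | yes refl = proj₁ between
    ...   | no i≢x   = offˣ i y i≢x y≢x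

module _ {D : Digraph (suc n)} {x y : Fin (suc n)} {A B : Graph n} (x≢y : x ≢ y)
         (iA : Iso (edge A) (del (edge (U D)) x)) (iB : Iso (edge B) (del (edge (U D)) y))
         (unique : UniquePasting (U D) A B) {E : Digraph (suc n)} (hyp : DaHypomorph D E) where

  private
    π : Permutation′ (suc n)
    π = proj₁ hyp

    card : ∀ z → Iso (del (arc D) z) (del (arc E) (π ⟨$⟩ʳ z))
    card z = proj₁ (proj₂ hyp z)

    π-injective : ∀ {a b} → π ⟨$⟩ʳ a ≡ π ⟨$⟩ʳ b → a ≡ b
    π-injective e = trans (sym (inverseˡ π)) (trans (cong (π ⟨$⟩ˡ_) e) (inverseˡ π))

    extend : Fin (suc n) → Permutation′ (suc n)
    extend z = insert z (π ⟨$⟩ʳ z) (σ (card z))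

    Iso-symmetrise-card : ∀ z → Iso (del (edge (U D)) z) (del (edge (U E)) (π ⟨$⟩ʳ z))
    Iso-symmetrise-card z = Iso-symmetrise {R = del (arc D) z} {del (arc E) (π ⟨$⟩ʳ z)} (card z)

    pD pE : Pasting (U D) A B
    pD = pastingByRemovingEdge (U D) (U D) x≢y iA iB (Hypomorph-refl {R = edge (U D)})
    pE = pastingByRemovingEdge (U D) (U E) (x≢y ∘ π-injective)
           (Iso-trans iA (Iso-symmetrise-card x)) (Iso-trans iB (Iso-symmetrise-card y))
           (Hypomorph-sym {R = edge (U D)} {edge (U E)} (DaHypomorph⇒Hypomorph-U {D = D} {E} hyp))

    sA = σ iA
    sB = σ iB

    embedA-pD : ∀ k → embedA pD (sA ⟨$⟩ˡ k) ≡ punchIn x k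
    embedA-pD k = cong (punchIn x) (inverseʳ sA)

    embedA-pE : ∀ k → embedA pE (sA ⟨$⟩ˡ k) ≡ extend x ⟨$⟩ʳ punchIn x k
    embedA-pE k = trans (cong (λ a → punchIn (π ⟨$⟩ʳ x) (σ (card x) ⟨$⟩ʳ a)) (inverseʳ sA))
                        (sym (insert-punchIn x (π ⟨$⟩ʳ x) (σ (card x)) k))

    embedB-pD : ∀ l → embedB pD (sB ⟨$⟩ˡ l) ≡ punchIn y l
    embedB-pD l = cong (punchIn y) (inverseʳ sB)

    embedB-pE : ∀ l → embedB pE (sB ⟨$⟩ˡ l) ≡ extend y ⟨$⟩ʳ punchIn y l
    embedB-pE l = trans (cong (λ b → punchIn (π ⟨$⟩ʳ y) (σ (card y) ⟨$⟩ʳ b)) (inverseʳ sB))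
                        (sym (insert-punchIn y (π ⟨$⟩ʳ y) (σ (card y)) l))

    extend-x-at-y : extend x ⟨$⟩ʳ y ≡ π ⟨$⟩ʳ y
    extend-x-at-y = begin
      extend x ⟨$⟩ʳ y              ≡⟨ cong (extend x ⟨$⟩ʳ_) hy ⟨
      extend x ⟨$⟩ʳ punchIn x k    ≡⟨ embedA-pE k ⟨
      embedA pE (sA ⟨$⟩ˡ k)        ≡⟨ vStar-transfer unique pD pE (trans (embedA-pD k) hy) ⟩
      π ⟨$⟩ʳ y                     ∎
      where
      k = punchOut x≢y
      hy = punchIn-punchOut x≢y

    extend-y-at-x : extend y ⟨$⟩ʳ x ≡ π ⟨$⟩ʳ x
    extend-y-at-x = begin
      extend y ⟨$⟩ʳ x              ≡⟨ cong (extend y ⟨$⟩ʳ_) hx ⟨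
      extend y ⟨$⟩ʳ punchIn y l    ≡⟨ embedB-pE l ⟨
      embedB pE (sB ⟨$⟩ˡ l)        ≡⟨ uStar-transfer unique pD pE (trans (embedB-pD l) hx) ⟩
      π ⟨$⟩ʳ x                     ∎
      where
      l = punchOut (x≢y ∘ sym)
      hx = punchIn-punchOut (x≢y ∘ sym)

    extend-agree-off : ∀ w → w ≢ x → w ≢ y → extend x ⟨$⟩ʳ w ≡ extend y ⟨$⟩ʳ w
    extend-agree-off w w≢x w≢y = begin
      extend x ⟨$⟩ʳ w              ≡⟨ cong (extend x ⟨$⟩ʳ_) hk ⟨
      extend x ⟨$⟩ʳ punchIn x k    ≡⟨ embedA-pE k ⟨
      embedA pE (sA ⟨$⟩ˡ k)        ≡⟨ glue-transfer unique pD pE glued ⟩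
      embedB pE (sB ⟨$⟩ˡ l)        ≡⟨ embedB-pE l ⟩
      extend y ⟨$⟩ʳ punchIn y l    ≡⟨ cong (extend y ⟨$⟩ʳ_) hl ⟩
      extend y ⟨$⟩ʳ w              ∎
      where
      k = punchOut (w≢x ∘ sym)
      l = punchOut (w≢y ∘ sym)
      hk = punchIn-punchOut (w≢x ∘ sym)
      hl = punchIn-punchOut (w≢y ∘ sym)
      glued : embedA pD (sA ⟨$⟩ˡ k) ≡ embedB pD (sB ⟨$⟩ˡ l)
      glued = trans (embedA-pD k) (trans hk (sym (trans (embedB-pD l) hl)))

    extend-agree : ∀ w → extend x ⟨$⟩ʳ w ≡ extend y ⟨$⟩ʳ w
    extend-agree w with w ≟ x | w ≟ y
    ... | yes refl | _        = trans (insert-self x _ _) (sym extend-y-at-x)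
    ... | no _     | yes refl = trans extend-x-at-y (sym (insert-self y _ _))
    ... | no w≢x   | no w≢y   = extend-agree-off w w≢x w≢y

    extend-preservesOff : ∀ z → PreservesOff (arc D) (arc E) (extend z) z
    extend-preservesOff z = insert-preservesOff {R = arc D} {arc E} {z} (card z)

    extend-x-preservesOff-y : PreservesOff (arc D) (arc E) (extend x) y
    extend-x-preservesOff-y i j i≢y j≢y =
      trans (extend-preservesOff y i j i≢y j≢y) (sym (cong₂ (arc E) (extend-agree i) (extend-agree j)))

  DaHypomorph⇒Iso : Iso (arc D) (arc E)
  DaHypomorph⇒Iso = Iso-fromPreservesOff D E (extend x) x≢y
    (extend-preservesOff x) extend-x-preservesOff-y
    (trans (proj₂ (proj₂ hyp x)) (cong (dt E) (sym (insert-self x _ _))))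

theorem6p4 : ∀ {n : ℕ} (D : Digraph (suc n)) (x y : Fin (suc n)) (A B : Graph n) →
    x ≢ y →
    Iso (edge A) (del (edge (U D)) x) →
    Iso (edge B) (del (edge (U D)) y) →
    UniquePasting (U D) A B →
    (∀ z → z ≢ x → z ≢ y →
      ¬ Iso (del (edge (U D)) z) (edge A) × ¬ Iso (del (edge (U D)) z) (edge B)) →
    DaReconstructible D
theorem6p4 D x y A B x≢y iA iB unique _ E hyp = DaHypomorph⇒Iso {D = D} x≢y iA iB unique {E} hyp
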